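{- Given a $V$-pointed higher-order GSOS law $\rho$ of $\Sigma$ over $B$, the triple $(\mu\Sigma,\iota,\iota^\clubsuit)$ is an initial object in the category of $\rho$-bialgebras.
   Context: $\mathbb{C}$ is a category with finite limits and finite colimits, $V$ an object, $\Sigma=V+\Sigma'\colon\mathbb{C}\to\mathbb{C}$ with $\Sigma'$ admitting free algebras (free monad $\Sigma^\star$), $B\colon\mathbb{C}^{\mathsf{op}}\times\mathbb{C}\to\mathbb{C}$ a functor; $j\colon V/\mathbb{C}\to\mathbb{C}$ the forgetful functor from the coslice category; each $\Sigma$-algebra $(A,a)$ is $V$-pointed via $a\circ\mathrm{inl}$. $(\mu\Sigma,\iota)$ is the initial $\Sigma$-algebra, $(\!|a|\!)$ the unique algebra morphism into $(A,a)$, $\hat a\colon\Sigma^\star A\to A$ the unique algebra morphism extending $\mathrm{id}_A$, $\nabla$ the codiagonal. A $V$-pointed higher-order GSOS law is a family $\rho_{X,Y}\colon\Sigma(jX\times B(jX,Y))\to B(jX,\Sigma^\star(jX+Y))$ dinatural in $X\in V/\mathbb{C}$ and natural in $Y\in\mathbb{C}$. $\iota^\clubsuit\colon\mu\Sigma\to B(\mu\Sigma,\mu\Sigma)$ is the unique morphism with $\iota^\clubsuit\circ\iota=B(\mathrm{id},\hat\iota)\circ B(\mathrm{id},\Sigma^\star\nabla)\circ\rho_{\mu\Sigma,\mu\Sigma}\circ\Sigma\langle\mathrm{id},\iota^\clubsuit\rangle$. A $\rho$-bialgebra is a triple $(A,a,c)$ with $a\colon\Sigma A\to A$, $c\colon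 A\to B(A,A)$ and $c\circ a=B(\mathrm{id},\hat a)\circ B(\mathrm{id},\Sigma^\star\nabla)\circ\rho_{A,A}\circ\Sigma\langle\mathrm{id},c\rangle$; a morphism $(A,a,c)\to(A',a',c')$ is a $\Sigma$-algebra morphism $h\colon A\to A'$ with $B(\mathrm{id}_A,h)\circ c=B(h,\mathrm{id}_{A'})\circ c'\circ h$. -}

module Defs where

open import Level using (Level; _⊔_) renaming (suc to lsuc)
open import Relation.Binary using (Rel; IsEquivalence)
import Data.Product as P
open P using (Σ-syntax)

record Category (o ℓ e : Level) : Set (lsuc (o ⊔ ℓ ⊔ e)) where
  infix  4 _≈_
  infix  5 _⇒_
  infixr 9 _∘_
  field
    Obj  : Set o
    _⇒_  : Obj → Obj → Set ℓ
    _≈_  : ∀ {A B} → Rel (A ⇒ B) e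
    id   : ∀ {A} → A ⇒ A
    _∘_  : ∀ {A B C} → B ⇒ C → A ⇒ B → A ⇒ C
    equiv     : ∀ {A B} → IsEquivalence (_≈_ {A} {B})
    assoc     : ∀ {A B C D} {f : A ⇒ B} {g : B ⇒ C} {h : C ⇒ D} →
                (h ∘ g) ∘ f ≈ h ∘ (g ∘ f)
    identityˡ : ∀ {A B} {f : A ⇒ B} → id ∘ f ≈ f
    identityʳ : ∀ {A B} {f : A ⇒ B} → f ∘ id ≈ f
    ∘-resp-≈  : ∀ {A B C} {f h : B ⇒ C} {g i : A ⇒ B} →
                f ≈ h → g ≈ i → f ∘ g ≈ h ∘ i

module _ {o ℓ e} (C : Category o ℓ e) where
  open Category C

  record Terminal : Set (o ⊔ ℓ ⊔ e) where
    field
      ⊤        : Obj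
      !        : ∀ {A} → A ⇒ ⊤
      !-unique : ∀ {A} (f : A ⇒ ⊤) → f ≈ !

  record Initial : Set (o ⊔ ℓ ⊔ e) where
    field
      ⊥        : Obj
      ¡        : ∀ {A} → ⊥ ⇒ A
      ¡-unique : ∀ {A} (f : ⊥ ⇒ A) → f ≈ ¡

  record BinaryProducts : Set (o ⊔ ℓ ⊔ e) where
    infixr 7 _×_
    field
      _×_      : Obj → Obj → Obj
      π₁       : ∀ {A B} → A × B ⇒ A
      π₂       : ∀ {A B} → A × B ⇒ B
      ⟨_,_⟩    : ∀ {X A B} → X ⇒ A → X ⇒ B → X ⇒ A × B
      project₁ : ∀ {X A B} {f : X ⇒ A} {g : X ⇒ B} → π₁ ∘ ⟨ f , g ⟩ ≈ f
      project₂ : ∀ {X A B} {f : X ⇒ A} {g : X ⇒ B} → π₂ ∘ ⟨ f , g ⟩ ≈ g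
      unique   : ∀ {X A B} {f : X ⇒ A} {g : X ⇒ B} {h : X ⇒ A × B} →
                 π₁ ∘ h ≈ f → π₂ ∘ h ≈ g → ⟨ f , g ⟩ ≈ h

  record BinaryCoproducts : Set (o ⊔ ℓ ⊔ e) where
    infixr 6 _+_
    field
      _+_      : Obj → Obj → Obj
      inl      : ∀ {A B} → A ⇒ A + B
      inr      : ∀ {A B} → B ⇒ A + B
      [_,_]    : ∀ {X A B} → A ⇒ X → B ⇒ X → A + B ⇒ X
      inject₁  : ∀ {X A B} {f : A ⇒ X} {g : B ⇒ X} → [ f , g ] ∘ inl ≈ f
      inject₂  : ∀ {X A B} {f : A ⇒ X} {g : B ⇒ X} → [ f , g ] ∘ inr ≈ g
      unique   : ∀ {X A B} {f : A ⇒ X} {g : B ⇒ X} {h : A + B ⇒ X} →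
                 h ∘ inl ≈ f → h ∘ inr ≈ g → [ f , g ] ≈ h

  record Equalizers : Set (o ⊔ ℓ ⊔ e) where
    field
      eqObj     : ∀ {A B} (f g : A ⇒ B) → Obj
      arr       : ∀ {A B} {f g : A ⇒ B} → eqObj f g ⇒ A
      equality  : ∀ {A B} {f g : A ⇒ B} → f ∘ arr {f = f} {g} ≈ g ∘ arr
      equalize  : ∀ {X A B} {f g : A ⇒ B} (h : X ⇒ A) → f ∘ h ≈ g ∘ h →
                  X ⇒ eqObj f g
      universal : ∀ {X A B} {f g : A ⇒ B} {h : X ⇒ A} (eq : f ∘ h ≈ g ∘ h) →
                  arr ∘ equalize h eq ≈ h
      unique    : ∀ {X A B} {f g : A ⇒ B} {h : X ⇒ A} (eq : f ∘ h ≈ g ∘ h)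
                  (i : X ⇒ eqObj f g) → arr ∘ i ≈ h → i ≈ equalize h eq

  record Coequalizers : Set (o ⊔ ℓ ⊔ e) where
    field
      coeqObj    : ∀ {A B} (f g : A ⇒ B) → Obj
      arr        : ∀ {A B} {f g : A ⇒ B} → B ⇒ coeqObj f g
      equality   : ∀ {A B} {f g : A ⇒ B} → arr {f = f} {g} ∘ f ≈ arr ∘ g
      coequalize : ∀ {X A B} {f g : A ⇒ B} (h : B ⇒ X) → h ∘ f ≈ h ∘ g →
                   coeqObj f g ⇒ X
      universal  : ∀ {X A B} {f g : A ⇒ B} {h : B ⇒ X} (eq : h ∘ f ≈ h ∘ g) →
                   coequalize h eq ∘ arr ≈ h
      unique     : ∀ {X A B} {f g : A ⇒ B} {h : B ⇒ X} (eq : h ∘ f ≈ h ∘ g)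
                   (i : coeqObj f g ⇒ X) → i ∘ arr ≈ h → i ≈ coequalize h eq

  record FiniteLimits : Set (o ⊔ ℓ ⊔ e) where
    field
      terminal : Terminal
      products : BinaryProducts
      equalizers : Equalizers

  record FiniteColimits : Set (o ⊔ ℓ ⊔ e) where
    field
      initial : Initial
      coproducts : BinaryCoproducts
      coequalizers : Coequalizers

  record Endofunctor : Set (o ⊔ ℓ ⊔ e) where
    field
      F₀ : Obj → Obj
      F₁ : ∀ {A B} → A ⇒ B → F₀ A ⇒ F₀ B
      identity     : ∀ {A} → F₁ (id {A}) ≈ id
      homomorphism : ∀ {A B C} {f : A ⇒ B} {g : B ⇒ C} →
                     F₁ (g ∘ f) ≈ F₁ g ∘ F₁ f
      F-resp-≈     : ∀ {A B} {f g : A ⇒ B} → f ≈ g → F₁ f ≈ F₁ g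

  record Bifunctor : Set (o ⊔ ℓ ⊔ e) where
    field
      B₀ : Obj → Obj → Obj
      B₁ : ∀ {A A′ X X′} → A′ ⇒ A → X ⇒ X′ → B₀ A X ⇒ B₀ A′ X′
      identity     : ∀ {A X} → B₁ (id {A}) (id {X}) ≈ id
      homomorphism : ∀ {A A′ A″ X X′ X″} {f : A′ ⇒ A} {f′ : A″ ⇒ A′}
                     {g : X ⇒ X′} {g′ : X′ ⇒ X″} →
                     B₁ (f ∘ f′) (g′ ∘ g) ≈ B₁ f′ g′ ∘ B₁ f g
      B-resp-≈     : ∀ {A A′ X X′} {f f′ : A′ ⇒ A} {g g′ : X ⇒ X′} →
                     f ≈ f′ → g ≈ g′ → B₁ f g ≈ B₁ f′ g′

  module _ (F₀ : Obj → Obj) (F₁ : ∀ {A B} → A ⇒ B → F₀ A ⇒ F₀ B) where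

    record Alg : Set (o ⊔ ℓ) where
      constructor alg
      field
        carrier   : Obj
        structure : F₀ carrier ⇒ carrier

    IsAlgHom : (A A′ : Alg) → Alg.carrier A ⇒ Alg.carrier A′ → Set e
    IsAlgHom (alg A a) (alg A′ a′) h = h ∘ a ≈ a′ ∘ F₁ h

    record InitialAlgebra : Set (o ⊔ ℓ ⊔ e) where
      field
        μ        : Alg
        fold     : (A : Alg) → Alg.carrier μ ⇒ Alg.carrier A
        fold-hom : (A : Alg) → IsAlgHom μ A (fold A)
        fold-unique : (A : Alg) (h : Alg.carrier μ ⇒ Alg.carrier A) →
                      IsAlgHom μ A h → h ≈ fold A

    record FreeAlgebras : Set (o ⊔ ℓ ⊔ e) where
      field
        free    : Obj → Alg
        η       : ∀ X → X ⇒ Alg.carrier (free X)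
        ext     : ∀ {X} (A : Alg) → X ⇒ Alg.carrier A →
                  Alg.carrier (free X) ⇒ Alg.carrier A
        ext-hom : ∀ {X} (A : Alg) (f : X ⇒ Alg.carrier A) →
                  IsAlgHom (free X) A (ext A f)
        ext-η   : ∀ {X} (A : Alg) (f : X ⇒ Alg.carrier A) →
                  ext A f ∘ η X ≈ f
        ext-unique : ∀ {X} (A : Alg) (f : X ⇒ Alg.carrier A)
                     (h : Alg.carrier (free X) ⇒ Alg.carrier A) →
                     IsAlgHom (free X) A h → h ∘ η X ≈ f → h ≈ ext A f

module Setting {o ℓ e} (C : Category o ℓ e)
  (lim : FiniteLimits C) (colim : FiniteColimits C)
  (V : Category.Obj C) (Σ′ : Endofunctor C) where

  open Category C
  open BinaryProducts (FiniteLimits.products lim)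
  open BinaryCoproducts (FiniteColimits.coproducts colim)
  open Endofunctor Σ′ renaming (F₀ to Σ′₀; F₁ to Σ′₁)

  _⊗₁_ : ∀ {A B A′ B′} → A ⇒ A′ → B ⇒ B′ → A × B ⇒ A′ × B′
  f ⊗₁ g = ⟨ f ∘ π₁ , g ∘ π₂ ⟩

  _⊕₁_ : ∀ {A B A′ B′} → A ⇒ A′ → B ⇒ B′ → A + B ⇒ A′ + B′
  f ⊕₁ g = [ inl ∘ f , inr ∘ g ]

  ∇ : ∀ {A} → A + A ⇒ A
  ∇ = [ id , id ]

  Σ₀ : Obj → Obj
  Σ₀ X = V + Σ′₀ X

  Σ₁ : ∀ {A B} → A ⇒ B → Σ₀ A ⇒ Σ₀ B
  Σ₁ f = id ⊕₁ Σ′₁ f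

  ΣAlg : Set (o ⊔ ℓ)
  ΣAlg = Alg C Σ₀ Σ₁

  -- objects of the coslice V/C ; j is the first projection
  record Pointed : Set (o ⊔ ℓ) where
    constructor pointed
    field
      obj : Obj
      pt  : V ⇒ obj

  j : Pointed → Obj
  j = Pointed.obj

  PointedHom : Pointed → Pointed → Set (ℓ ⊔ e)
  PointedHom X X′ = Σ[ h ∈ j X ⇒ j X′ ] (h ∘ Pointed.pt X ≈ Pointed.pt X′)

  algPointed : ΣAlg → Pointed
  algPointed (alg A a) = pointed A (a ∘ inl)

  module FreeMonad (Σ⋆ : FreeAlgebras C Σ₀ Σ₁) where
    open FreeAlgebras Σ⋆

    Σ⋆₀ : Obj → Obj
    Σ⋆₀ X = Alg.carrier (free X)

    Σ⋆₁ : ∀ {X Y} → X ⇒ Y → Σ⋆₀ X ⇒ Σ⋆₀ Y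
    Σ⋆₁ {X} {Y} f = ext (free Y) (η Y ∘ f)

    hat : (A : ΣAlg) → Σ⋆₀ (Alg.carrier A) ⇒ Alg.carrier A
    hat A = ext A id

    module Law (Bf : Bifunctor C) where
      open Bifunctor Bf

      record GSOSLaw : Set (o ⊔ ℓ ⊔ e) where
        field
          ρ : (X : Pointed) (Y : Obj) →
              Σ₀ (j X × B₀ (j X) Y) ⇒ B₀ (j X) (Σ⋆₀ (j X + Y))
          dinatural : ∀ {X X′ : Pointed} {Y} (h : PointedHom X X′) →
            B₁ id (Σ⋆₁ (P.proj₁ h ⊕₁ id)) ∘ ρ X Y ∘ Σ₁ (id ⊗₁ B₁ (P.proj₁ h) id)
            ≈ B₁ (P.proj₁ h) id ∘ ρ X′ Y ∘ Σ₁ (P.proj₁ h ⊗₁ id)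
          natural : ∀ {X : Pointed} {Y Y′} (g : Y ⇒ Y′) →
            B₁ id (Σ⋆₁ (id ⊕₁ g)) ∘ ρ X Y ≈ ρ X Y′ ∘ Σ₁ (id ⊗₁ B₁ id g)

      module Bialgebras (law : GSOSLaw) where
        open GSOSLaw law

        IsBialgebra : (A : ΣAlg) → Alg.carrier A ⇒ B₀ (Alg.carrier A) (Alg.carrier A) → Set e
        IsBialgebra A c =
          c ∘ Alg.structure A
          ≈ B₁ id (hat A) ∘ B₁ id (Σ⋆₁ ∇) ∘ ρ (algPointed A) (Alg.carrier A) ∘ Σ₁ ⟨ id , c ⟩

        IsBialgebraHom : (A : ΣAlg) (c : Alg.carrier A ⇒ B₀ (Alg.carrier A) (Alg.carrier A))
                         (A′ : ΣAlg) (c′ : Alg.carrier A′ ⇒ B₀ (Alg.carrier A′) (Alg.carrier A′))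
                         (h : Alg.carrier A ⇒ Alg.carrier A′) → Set e
        IsBialgebraHom A c A′ c′ h =
          IsAlgHom C Σ₀ Σ₁ A A′ h P.×
          (B₁ id h ∘ c ≈ B₁ h id ∘ c′ ∘ h)

        IsInitialBialgebra : (A : ΣAlg) (c : Alg.carrier A ⇒ B₀ (Alg.carrier A) (Alg.carrier A)) →
                             Set (o ⊔ ℓ ⊔ e)
        IsInitialBialgebra A c =
          IsBialgebra A c P.×
          ((A′ : ΣAlg) (c′ : Alg.carrier A′ ⇒ B₀ (Alg.carrier A′) (Alg.carrier A′)) →
           IsBialgebra A′ c′ →
           Σ[ h ∈ Alg.carrier A ⇒ Alg.carrier A′ ]
             (IsBialgebraHom A c A′ c′ h P.×
              ((h′ : Alg.carrier A ⇒ Alg.carrier A′) →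
               IsBialgebraHom A c A′ c′ h′ → h′ ≈ h)))

        module _ (init : InitialAlgebra C Σ₀ Σ₁) where
          open InitialAlgebra init

          μΣ : Obj
          μΣ = Alg.carrier μ

          ι : Σ₀ μΣ ⇒ μΣ
          ι = Alg.structure μ

          Proposition : Set (o ⊔ ℓ ⊔ e)
          Proposition =
            Σ[ ι♣ ∈ μΣ ⇒ B₀ μΣ μΣ ]
              (IsBialgebra μ ι♣ P.×
               ((c : μΣ ⇒ B₀ μΣ μΣ) → IsBialgebra μ c → c ≈ ι♣) P.×
               IsInitialBialgebra μ ι♣)

-- ι♣ is defined by primitive recursion over the initial Σ-algebra (the second component of the
-- fold into μΣ × B(μΣ, μΣ)), which yields both the bialgebra law for ι♣ and its uniqueness.
-- For a bialgebra (A, a, c) the only candidate morphism is the fold h : μΣ → A. The two sides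
-- B(id, h) ∘ ι♣ and B(h, id) ∘ c ∘ h of the bialgebra-morphism square solve one and the same
-- primitive-recursion equation: the first by naturality of ρ in Y, the second by dinaturality
-- of ρ in X, which applies because h, being an algebra morphism, preserves the V-points.
-- Uniqueness of primitive-recursive solutions makes the square commute.
module Submission where

open import Level using (_⊔_)

open import Data.Product using (_,_; proj₁)
open import Relation.Binary.Bundles using (Setoid)
open import Relation.Binary.Structures using (IsEquivalence)
import Relation.Binary.Reasoning.Setoid as SetoidReasoning
open import Defs

module HomReasoning {o ℓ e} (C : Category o ℓ e) where
  open Category C

  hom-setoid : Obj → Obj → Setoid ℓ e
  hom-setoid A B = record { Carrier = A ⇒ B ; _≈_ = _≈_ ; isEquivalence = equiv }

  module _ {A B : Obj} where
    open IsEquivalence (equiv {A} {B}) public using (refl; sym; trans)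
    open SetoidReasoning (hom-setoid A B) public

  infixr 4 refl⟩∘⟨_
  infixl 5 _⟩∘⟨refl

  refl⟩∘⟨_ : ∀ {A B C} {f : B ⇒ C} {g i : A ⇒ B} → g ≈ i → f ∘ g ≈ f ∘ i
  refl⟩∘⟨ q = ∘-resp-≈ refl q

  _⟩∘⟨refl : ∀ {A B C} {f h : B ⇒ C} {g : A ⇒ B} → f ≈ h → f ∘ g ≈ h ∘ g
  p ⟩∘⟨refl = ∘-resp-≈ p refl

  sym-assoc : ∀ {A B C D} {f : A ⇒ B} {g : B ⇒ C} {h : C ⇒ D} →
              h ∘ (g ∘ f) ≈ (h ∘ g) ∘ f
  sym-assoc = sym assoc

  pullˡ : ∀ {W X Y Z} {f : W ⇒ X} {g : X ⇒ Y} {h : Y ⇒ Z} {k : X ⇒ Z} →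
          h ∘ g ≈ k → h ∘ (g ∘ f) ≈ k ∘ f
  pullˡ p = trans sym-assoc (p ⟩∘⟨refl)

  pullʳ : ∀ {W X Y Z} {f : W ⇒ X} {g : X ⇒ Y} {h : Y ⇒ Z} {k : W ⇒ Y} →
          g ∘ f ≈ k → (h ∘ g) ∘ f ≈ h ∘ k
  pullʳ p = trans assoc (refl⟩∘⟨ p)

  id-comm-sym : ∀ {A B} {f : A ⇒ B} → id ∘ f ≈ f ∘ id
  id-comm-sym = trans identityˡ (sym identityʳ)

  assoc² : ∀ {V W X Y Z} {f : Y ⇒ Z} {g : X ⇒ Y} {h : W ⇒ X} {k : V ⇒ W} →
           (f ∘ g ∘ h) ∘ k ≈ f ∘ g ∘ h ∘ k
  assoc² = trans assoc (refl⟩∘⟨ assoc)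

module ProductLemmas {o ℓ e} {C : Category o ℓ e} (P : BinaryProducts C) where
  open Category C
  open HomReasoning C
  open BinaryProducts P

  ⟨⟩-cong₂ : ∀ {X A B} {f f′ : X ⇒ A} {g g′ : X ⇒ B} →
             f ≈ f′ → g ≈ g′ → ⟨ f , g ⟩ ≈ ⟨ f′ , g′ ⟩
  ⟨⟩-cong₂ p q = sym (unique (trans project₁ p) (trans project₂ q))

  ⟨⟩∘ : ∀ {W X A B} {f : X ⇒ A} {g : X ⇒ B} {k : W ⇒ X} →
        ⟨ f , g ⟩ ∘ k ≈ ⟨ f ∘ k , g ∘ k ⟩
  ⟨⟩∘ = sym (unique (pullˡ project₁) (pullˡ project₂))

  ×₁∘⟨⟩ : ∀ {X A B A′ B′} {f : A ⇒ A′} {g : B ⇒ B′} {p : X ⇒ A} {q : X ⇒ B} →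
          ⟨ f ∘ π₁ , g ∘ π₂ ⟩ ∘ ⟨ p , q ⟩ ≈ ⟨ f ∘ p , g ∘ q ⟩
  ×₁∘⟨⟩ = trans ⟨⟩∘ (⟨⟩-cong₂ (pullʳ project₁) (pullʳ project₂))

  id×₁∘⟨id,⟩ : ∀ {X B B′} {k : B ⇒ B′} {g : X ⇒ B} →
               ⟨ id ∘ π₁ , k ∘ π₂ ⟩ ∘ ⟨ id , g ⟩ ≈ ⟨ id , k ∘ g ⟩
  id×₁∘⟨id,⟩ = trans ×₁∘⟨⟩ (⟨⟩-cong₂ identityˡ refl)

module CoproductLemmas {o ℓ e} {C : Category o ℓ e} (P : BinaryCoproducts C) where
  open Category C
  open HomReasoning C
  open BinaryCoproducts P

  []-cong₂ : ∀ {X A B} {f f′ : A ⇒ X} {g g′ : B ⇒ X} →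
             f ≈ f′ → g ≈ g′ → [ f , g ] ≈ [ f′ , g′ ]
  []-cong₂ p q = sym (unique (trans inject₁ p) (trans inject₂ q))

  ∘[] : ∀ {X Y A B} {f : A ⇒ X} {g : B ⇒ X} {k : X ⇒ Y} →
        k ∘ [ f , g ] ≈ [ k ∘ f , k ∘ g ]
  ∘[] = sym (unique (pullʳ inject₁) (pullʳ inject₂))

  []∘+₁ : ∀ {X A B A′ B′} {f : A′ ⇒ X} {g : B′ ⇒ X} {p : A ⇒ A′} {q : B ⇒ B′} →
          [ f , g ] ∘ [ inl ∘ p , inr ∘ q ] ≈ [ f ∘ p , g ∘ q ]
  []∘+₁ = trans ∘[] ([]-cong₂ (pullˡ inject₁) (pullˡ inject₂))

  +-η : ∀ {A B} → [ inl , inr ] ≈ id {A + B}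
  +-η = unique identityˡ identityˡ

module _ {o ℓ e} {C : Category o ℓ e} (P : BinaryCoproducts C) where
  open Category C
  open HomReasoning C
  open BinaryCoproducts P
  open CoproductLemmas P

  constant+ : Obj → Endofunctor C → Endofunctor C
  constant+ V F = record
    { F₀ = λ X → V + F₀ X
    ; F₁ = λ f → [ inl ∘ id , inr ∘ F₁ f ]
    ; identity = trans ([]-cong₂ identityʳ (trans (refl⟩∘⟨ identity) identityʳ)) +-η
    ; homomorphism = sym (trans []∘+₁ ([]-cong₂ (pullʳ identityˡ) (pullʳ (sym homomorphism))))
    ; F-resp-≈ = λ p → []-cong₂ refl (refl⟩∘⟨ F-resp-≈ p)
    }
    where open Endofunctor F

module BifunctorLemmas {o ℓ e} {C : Category o ℓ e} (B : Bifunctor C) where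
  open Category C
  open HomReasoning C
  open Bifunctor B

  B₁-id-∘ : ∀ {A X Y Z} {f : X ⇒ Y} {g : Y ⇒ Z} →
            B₁ (id {A}) g ∘ B₁ id f ≈ B₁ id (g ∘ f)
  B₁-id-∘ = sym (trans (B-resp-≈ (sym identityˡ) refl) homomorphism)

  B₁-commute : ∀ {A A′ X Y} {h : A′ ⇒ A} {k : X ⇒ Y} →
               B₁ h id ∘ B₁ id k ≈ B₁ id k ∘ B₁ h id
  B₁-commute {h = h} {k} = begin
    B₁ h id ∘ B₁ id k    ≈⟨ homomorphism ⟨
    B₁ (id ∘ h) (id ∘ k) ≈⟨ B-resp-≈ id-comm-sym id-comm-sym ⟩
    B₁ (h ∘ id) (k ∘ id) ≈⟨ homomorphism ⟩
    B₁ id k ∘ B₁ h id    ∎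

module AlgebraLemmas {o ℓ e} {C : Category o ℓ e} (F : Endofunctor C) where
  open Category C
  open HomReasoning C
  open Endofunctor F

  FAlg : Set (o ⊔ ℓ)
  FAlg = Alg C F₀ F₁

  IsHom : (X Y : FAlg) → Alg.carrier X ⇒ Alg.carrier Y → Set e
  IsHom = IsAlgHom C F₀ F₁

  isHom-id : (X : FAlg) → IsHom X X id
  isHom-id X = trans identityˡ (trans (sym identityʳ) (refl⟩∘⟨ sym identity))

  isHom-∘ : (X Y Z : FAlg) {f : Alg.carrier X ⇒ Alg.carrier Y} {g : Alg.carrier Y ⇒ Alg.carrier Z} →
            IsHom X Y f → IsHom Y Z g → IsHom X Z (g ∘ f)
  isHom-∘ (alg X x) (alg Y y) (alg Z z) {f} {g} f-hom g-hom = begin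
    (g ∘ f) ∘ x       ≈⟨ pullʳ f-hom ⟩
    g ∘ y ∘ F₁ f      ≈⟨ pullˡ g-hom ⟩
    (z ∘ F₁ g) ∘ F₁ f ≈⟨ pullʳ (sym homomorphism) ⟩
    z ∘ F₁ (g ∘ f)    ∎

  module PrimitiveRecursion (P : BinaryProducts C) (init : InitialAlgebra C F₀ F₁) where
    open BinaryProducts P
    open ProductLemmas P
    open InitialAlgebra init

    private
      M : Obj
      M = Alg.carrier μ

      ι : F₀ M ⇒ M
      ι = Alg.structure μ

    module _ {D : Obj} (R : F₀ (M × D) ⇒ D) where

      Solves : M ⇒ D → Set e
      Solves g = g ∘ ι ≈ R ∘ F₁ ⟨ id , g ⟩

      graphAlgebra : FAlg
      graphAlgebra = alg (M × D) ⟨ ι ∘ F₁ π₁ , R ⟩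

      graph-isHom : {g : M ⇒ D} → Solves g → IsHom μ graphAlgebra ⟨ id , g ⟩
      graph-isHom {g} g-solves = begin
        ⟨ id , g ⟩ ∘ ι                                     ≈⟨ ⟨⟩∘ ⟩
        ⟨ id ∘ ι , g ∘ ι ⟩                                 ≈⟨ ⟨⟩-cong₂ ι-eq g-solves ⟩
        ⟨ (ι ∘ F₁ π₁) ∘ F₁ ⟨ id , g ⟩ , R ∘ F₁ ⟨ id , g ⟩ ⟩ ≈⟨ ⟨⟩∘ ⟨
        ⟨ ι ∘ F₁ π₁ , R ⟩ ∘ F₁ ⟨ id , g ⟩                  ∎
        where
        ι-eq : id ∘ ι ≈ (ι ∘ F₁ π₁) ∘ F₁ ⟨ id , g ⟩
        ι-eq = begin
          id ∘ ι                        ≈⟨ identityˡ ⟩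
          ι                             ≈⟨ identityʳ ⟨
          ι ∘ id                        ≈⟨ refl⟩∘⟨ trans (F-resp-≈ project₁) identity ⟨
          ι ∘ F₁ (π₁ ∘ ⟨ id , g ⟩)      ≈⟨ pullʳ (sym homomorphism) ⟨
          (ι ∘ F₁ π₁) ∘ F₁ ⟨ id , g ⟩   ∎

      rec : M ⇒ D
      rec = π₂ ∘ fold graphAlgebra

      fold-graph : fold graphAlgebra ≈ ⟨ id , rec ⟩
      fold-graph = sym (unique π₁∘fold refl)
        where
        π₁-isHom : IsHom graphAlgebra μ π₁
        π₁-isHom = project₁

        π₁∘fold : π₁ ∘ fold graphAlgebra ≈ id
        π₁∘fold = begin
          π₁ ∘ fold graphAlgebra ≈⟨ fold-unique μ _ (isHom-∘ μ graphAlgebra μ (fold-hom graphAlgebra) π₁-isHom) ⟩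
          fold μ                 ≈⟨ fold-unique μ id (isHom-id μ) ⟨
          id                     ∎

      rec-solves : Solves rec
      rec-solves = begin
        (π₂ ∘ fold graphAlgebra) ∘ ι                 ≈⟨ pullʳ (fold-hom graphAlgebra) ⟩
        π₂ ∘ ⟨ ι ∘ F₁ π₁ , R ⟩ ∘ F₁ (fold graphAlgebra) ≈⟨ pullˡ project₂ ⟩
        R ∘ F₁ (fold graphAlgebra)                    ≈⟨ refl⟩∘⟨ F-resp-≈ fold-graph ⟩
        R ∘ F₁ ⟨ id , rec ⟩                           ∎

      rec-unique : {g : M ⇒ D} → Solves g → g ≈ rec
      rec-unique {g} g-solves = begin
        g                      ≈⟨ project₂ ⟨
        π₂ ∘ ⟨ id , g ⟩        ≈⟨ refl⟩∘⟨ fold-unique graphAlgebra _ (graph-isHom g-solves) ⟩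
        π₂ ∘ fold graphAlgebra ∎

  module FreeAlgebra (free-algebras : FreeAlgebras C F₀ F₁) where
    open FreeAlgebras free-algebras

    private
      Free : Obj → Obj
      Free X = Alg.carrier (free X)

    ext-unique₂ : ∀ {X} (A : FAlg) {f g : Free X ⇒ Alg.carrier A} →
                  IsHom (free X) A f → IsHom (free X) A g → f ∘ η X ≈ g ∘ η X → f ≈ g
    ext-unique₂ {X} A {f} {g} f-hom g-hom f≈g = begin
      f                 ≈⟨ ext-unique A (g ∘ η X) f f-hom f≈g ⟩
      ext A (g ∘ η X)   ≈⟨ ext-unique A (g ∘ η X) g g-hom refl ⟨
      g                 ∎

    free₁ : ∀ {X Y} → X ⇒ Y → Free X ⇒ Free Y
    free₁ {Y = Y} f = ext (free Y) (η Y ∘ f)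

    free₁-η : ∀ {X Y} (f : X ⇒ Y) → free₁ f ∘ η X ≈ η Y ∘ f
    free₁-η {Y = Y} f = ext-η (free Y) (η Y ∘ f)

    free₁-isHom : ∀ {X Y} (f : X ⇒ Y) → IsHom (free X) (free Y) (free₁ f)
    free₁-isHom {Y = Y} f = ext-hom (free Y) (η Y ∘ f)

    free₁-∘ : ∀ {X Y Z} {f : X ⇒ Y} {g : Y ⇒ Z} → free₁ (g ∘ f) ≈ free₁ g ∘ free₁ f
    free₁-∘ {X} {Y} {Z} {f} {g} =
      ext-unique₂ (free Z) (free₁-isHom (g ∘ f))
        (isHom-∘ (free X) (free Y) (free Z) (free₁-isHom f) (free₁-isHom g))
        (begin
          free₁ (g ∘ f) ∘ η X       ≈⟨ free₁-η (g ∘ f) ⟩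
          η Z ∘ g ∘ f               ≈⟨ sym-assoc ⟩
          (η Z ∘ g) ∘ f             ≈⟨ free₁-η g ⟩∘⟨refl ⟨
          (free₁ g ∘ η Y) ∘ f       ≈⟨ assoc ⟩
          free₁ g ∘ η Y ∘ f         ≈⟨ refl⟩∘⟨ free₁-η f ⟨
          free₁ g ∘ free₁ f ∘ η X   ≈⟨ sym-assoc ⟩
          (free₁ g ∘ free₁ f) ∘ η X ∎)

    free₁-resp-≈ : ∀ {X Y} {f g : X ⇒ Y} → f ≈ g → free₁ f ≈ free₁ g
    free₁-resp-≈ {Y = Y} {f} {g} f≈g =
      ext-unique₂ (free Y) (free₁-isHom f) (free₁-isHom g)
        (trans (free₁-η f) (trans (refl⟩∘⟨ f≈g) (sym (free₁-η g))))

    counit : (A : FAlg) → Free (Alg.carrier A) ⇒ Alg.carrier A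
    counit A = ext A id

    counit-natural : (X A : FAlg) {h : Alg.carrier X ⇒ Alg.carrier A} → IsHom X A h →
                     h ∘ counit X ≈ counit A ∘ free₁ h
    counit-natural X A {h} h-hom =
      ext-unique₂ A (isHom-∘ (free _) X A (ext-hom X id) h-hom)
        (isHom-∘ (free _) (free _) A (free₁-isHom h) (ext-hom A id))
        (begin
          (h ∘ counit X) ∘ η _       ≈⟨ pullʳ (ext-η X id) ⟩
          h ∘ id                     ≈⟨ identityʳ ⟩
          h                          ≈⟨ identityˡ ⟨
          id ∘ h                     ≈⟨ pullˡ (ext-η A id) ⟨
          counit A ∘ η _ ∘ h         ≈⟨ refl⟩∘⟨ free₁-η h ⟨
          counit A ∘ free₁ h ∘ η _   ≈⟨ sym-assoc ⟩
          (counit A ∘ free₁ h) ∘ η _ ∎)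

module Initiality {o ℓ e} (C : Category o ℓ e)
    (lim : FiniteLimits C) (colim : FiniteColimits C)
    (V : Category.Obj C) (Σ′ : Endofunctor C)
    (Σ⋆ : FreeAlgebras C (Setting.Σ₀ C lim colim V Σ′) (Setting.Σ₁ C lim colim V Σ′))
    (B : Bifunctor C)
    (law : Setting.FreeMonad.Law.GSOSLaw C lim colim V Σ′ Σ⋆ B)
    (init : InitialAlgebra C (Setting.Σ₀ C lim colim V Σ′) (Setting.Σ₁ C lim colim V Σ′)) where

  open Category C
  open HomReasoning C
  open BinaryProducts (FiniteLimits.products lim) using (_×_; ⟨_,_⟩)
  open BinaryCoproducts (FiniteColimits.coproducts colim) using (_+_; inl; [_,_]; inject₁)
  open ProductLemmas (FiniteLimits.products lim)
  open CoproductLemmas (FiniteColimits.coproducts colim)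
  open Setting C lim colim V Σ′
  open FreeMonad Σ⋆
  open Law B
  open Bialgebras law using (IsBialgebra; IsBialgebraHom; IsInitialBialgebra)
  open GSOSLaw law
  open InitialAlgebra init
  open Bifunctor B using (B₀; B₁; B-resp-≈)
  open BifunctorLemmas B

  -- Its object and morphism maps are definitionally Σ₀ and Σ₁.
  Σ-functor : Endofunctor C
  Σ-functor = constant+ (FiniteColimits.coproducts colim) V Σ′

  open Endofunctor Σ-functor using () renaming (homomorphism to Σ₁-∘; F-resp-≈ to Σ₁-resp-≈)
  open AlgebraLemmas Σ-functor
  open PrimitiveRecursion (FiniteLimits.products lim) init
  open FreeAlgebra Σ⋆

  μΣ : Obj
  μΣ = Alg.carrier μ

  ι : Σ₀ μΣ ⇒ μΣ
  ι = Alg.structure μ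

  bialgebraStep : (A : ΣAlg) →
    Σ₀ (Alg.carrier A × B₀ (Alg.carrier A) (Alg.carrier A)) ⇒ B₀ (Alg.carrier A) (Alg.carrier A)
  bialgebraStep A = B₁ id (hat A ∘ Σ⋆₁ ∇) ∘ ρ (algPointed A) (Alg.carrier A)

  bialgebraStep-split : (A : ΣAlg) {X : Obj} (w : X ⇒ Σ₀ (Alg.carrier A × B₀ (Alg.carrier A) (Alg.carrier A))) →
    B₁ id (hat A) ∘ B₁ id (Σ⋆₁ ∇) ∘ ρ (algPointed A) (Alg.carrier A) ∘ w ≈ bialgebraStep A ∘ w
  bialgebraStep-split A w = trans (pullˡ B₁-id-∘) sym-assoc

  ι♣ : μΣ ⇒ B₀ μΣ μΣ
  ι♣ = rec (bialgebraStep μ)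

  ι♣-isBialgebra : IsBialgebra μ ι♣
  ι♣-isBialgebra = trans (rec-solves (bialgebraStep μ)) (sym (bialgebraStep-split μ _))

  isBialgebra⇒≈ι♣ : (c : μΣ ⇒ B₀ μΣ μΣ) → IsBialgebra μ c → c ≈ ι♣
  isBialgebra⇒≈ι♣ c c-bialg = rec-unique (bialgebraStep μ) (trans c-bialg (bialgebraStep-split μ _))

  module FoldIsBialgebraHom (A : ΣAlg) (c : Alg.carrier A ⇒ B₀ (Alg.carrier A) (Alg.carrier A))
                            (c-bialg : IsBialgebra A c) where
    private
      A₀ : Obj
      A₀ = Alg.carrier A

      a : Σ₀ A₀ ⇒ A₀
      a = Alg.structure A

      h : μΣ ⇒ A₀
      h = fold A

    fold-pointed : PointedHom (algPointed μ) (algPointed A)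
    fold-pointed = h , (begin
      h ∘ ι ∘ inl      ≈⟨ pullˡ (fold-hom A) ⟩
      (a ∘ Σ₁ h) ∘ inl ≈⟨ pullʳ (trans inject₁ identityʳ) ⟩
      a ∘ inl          ∎)

    recursionStep : Σ₀ (μΣ × B₀ μΣ A₀) ⇒ B₀ μΣ A₀
    recursionStep = B₁ id (hat A ∘ Σ⋆₁ [ h , id ]) ∘ ρ (algPointed μ) A₀

    hat-∘-Σ⋆∇ : h ∘ hat μ ∘ Σ⋆₁ ∇ ≈ (hat A ∘ Σ⋆₁ [ h , id ]) ∘ Σ⋆₁ (id ⊕₁ h)
    hat-∘-Σ⋆∇ = begin
      h ∘ hat μ ∘ Σ⋆₁ ∇                    ≈⟨ pullˡ (counit-natural μ A (fold-hom A)) ⟩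
      (hat A ∘ Σ⋆₁ h) ∘ Σ⋆₁ ∇              ≈⟨ pullʳ (sym free₁-∘) ⟩
      hat A ∘ Σ⋆₁ (h ∘ ∇)                  ≈⟨ refl⟩∘⟨ free₁-resp-≈ h∘∇ ⟩
      hat A ∘ Σ⋆₁ ([ h , id ] ∘ (id ⊕₁ h)) ≈⟨ refl⟩∘⟨ free₁-∘ ⟩
      hat A ∘ Σ⋆₁ [ h , id ] ∘ Σ⋆₁ (id ⊕₁ h) ≈⟨ sym-assoc ⟩
      (hat A ∘ Σ⋆₁ [ h , id ]) ∘ Σ⋆₁ (id ⊕₁ h) ∎
      where
      h∘∇ : h ∘ ∇ ≈ [ h , id ] ∘ (id ⊕₁ h)
      h∘∇ = trans ∘[] (trans ([]-cong₂ refl (sym id-comm-sym)) (sym []∘+₁))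

    Σ⋆∇-∘-Σ⋆⊕ : (hat A ∘ Σ⋆₁ ∇) ∘ Σ⋆₁ (h ⊕₁ id) ≈ hat A ∘ Σ⋆₁ [ h , id ]
    Σ⋆∇-∘-Σ⋆⊕ = pullʳ (trans (sym free₁-∘) (free₁-resp-≈ (trans []∘+₁ ([]-cong₂ identityˡ identityˡ))))

    covariant-side-solves : Solves recursionStep (B₁ id h ∘ ι♣)
    covariant-side-solves = begin
      (B₁ id h ∘ ι♣) ∘ ι
        ≈⟨ pullʳ (rec-solves (bialgebraStep μ)) ⟩
      B₁ id h ∘ (B₁ id (hat μ ∘ Σ⋆₁ ∇) ∘ ρ (algPointed μ) μΣ) ∘ S
        ≈⟨ trans (refl⟩∘⟨ assoc) (pullˡ B₁-id-∘) ⟩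
      B₁ id (h ∘ hat μ ∘ Σ⋆₁ ∇) ∘ ρ (algPointed μ) μΣ ∘ S
        ≈⟨ trans (B-resp-≈ refl hat-∘-Σ⋆∇) (sym B₁-id-∘) ⟩∘⟨refl ⟩
      (B₁ id (hat A ∘ Σ⋆₁ [ h , id ]) ∘ B₁ id (Σ⋆₁ (id ⊕₁ h))) ∘ ρ (algPointed μ) μΣ ∘ S
        ≈⟨ trans assoc (refl⟩∘⟨ pullˡ (natural h)) ⟩
      B₁ id (hat A ∘ Σ⋆₁ [ h , id ]) ∘ (ρ (algPointed μ) A₀ ∘ Σ₁ (id ⊗₁ B₁ id h)) ∘ S
        ≈⟨ refl⟩∘⟨ pullʳ (trans (sym Σ₁-∘) (Σ₁-resp-≈ id×₁∘⟨id,⟩)) ⟩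
      B₁ id (hat A ∘ Σ⋆₁ [ h , id ]) ∘ ρ (algPointed μ) A₀ ∘ Σ₁ ⟨ id , B₁ id h ∘ ι♣ ⟩
        ≈⟨ sym-assoc ⟩
      recursionStep ∘ Σ₁ ⟨ id , B₁ id h ∘ ι♣ ⟩ ∎
      where
      S : Σ₀ μΣ ⇒ Σ₀ (μΣ × B₀ μΣ μΣ)
      S = Σ₁ ⟨ id , ι♣ ⟩

    contravariant-side-solves : Solves recursionStep (B₁ h id ∘ c ∘ h)
    contravariant-side-solves = begin
      (B₁ h id ∘ c ∘ h) ∘ ι
        ≈⟨ trans (pullʳ (pullʳ (fold-hom A))) (refl⟩∘⟨ sym-assoc) ⟩
      B₁ h id ∘ (c ∘ a) ∘ Σ₁ h
        ≈⟨ refl⟩∘⟨ trans c-bialg (bialgebraStep-split A _) ⟩∘⟨refl ⟩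
      B₁ h id ∘ (bialgebraStep A ∘ Σ₁ ⟨ id , c ⟩) ∘ Σ₁ h
        ≈⟨ refl⟩∘⟨ trans (pullʳ graph-∘-h) assoc ⟩
      B₁ h id ∘ Bx ∘ ρ (algPointed A) A₀ ∘ Σ₁ (h ⊗₁ id) ∘ T
        ≈⟨ trans (pullˡ B₁-commute) assoc ⟩
      Bx ∘ B₁ h id ∘ ρ (algPointed A) A₀ ∘ Σ₁ (h ⊗₁ id) ∘ T
        ≈⟨ refl⟩∘⟨ trans (sym assoc²) (trans (sym (dinatural fold-pointed) ⟩∘⟨refl) assoc²) ⟩
      Bx ∘ B₁ id (Σ⋆₁ (h ⊕₁ id)) ∘ ρ (algPointed μ) A₀ ∘ Σ₁ (id ⊗₁ B₁ h id) ∘ T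
        ≈⟨ pullˡ (trans B₁-id-∘ (B-resp-≈ refl Σ⋆∇-∘-Σ⋆⊕)) ⟩
      B₁ id (hat A ∘ Σ⋆₁ [ h , id ]) ∘ ρ (algPointed μ) A₀ ∘ Σ₁ (id ⊗₁ B₁ h id) ∘ T
        ≈⟨ refl⟩∘⟨ refl⟩∘⟨ trans (sym Σ₁-∘) (Σ₁-resp-≈ id×₁∘⟨id,⟩) ⟩
      B₁ id (hat A ∘ Σ⋆₁ [ h , id ]) ∘ ρ (algPointed μ) A₀ ∘ Σ₁ ⟨ id , B₁ h id ∘ c ∘ h ⟩
        ≈⟨ sym-assoc ⟩
      recursionStep ∘ Σ₁ ⟨ id , B₁ h id ∘ c ∘ h ⟩ ∎
      where
      Bx : ∀ {Z} → B₀ Z (Σ⋆₀ (A₀ + A₀)) ⇒ B₀ Z A₀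
      Bx = B₁ id (hat A ∘ Σ⋆₁ ∇)

      T : Σ₀ μΣ ⇒ Σ₀ (μΣ × B₀ A₀ A₀)
      T = Σ₁ ⟨ id , c ∘ h ⟩

      graph-∘-h : Σ₁ ⟨ id , c ⟩ ∘ Σ₁ h ≈ Σ₁ (h ⊗₁ id) ∘ T
      graph-∘-h = begin
        Σ₁ ⟨ id , c ⟩ ∘ Σ₁ h          ≈⟨ Σ₁-∘ ⟨
        Σ₁ (⟨ id , c ⟩ ∘ h)           ≈⟨ Σ₁-resp-≈ (trans ⟨⟩∘ (⟨⟩-cong₂ id-comm-sym (sym identityˡ))) ⟩
        Σ₁ ⟨ h ∘ id , id ∘ c ∘ h ⟩    ≈⟨ Σ₁-resp-≈ ×₁∘⟨⟩ ⟨
        Σ₁ ((h ⊗₁ id) ∘ ⟨ id , c ∘ h ⟩) ≈⟨ Σ₁-∘ ⟩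
        Σ₁ (h ⊗₁ id) ∘ T              ∎

    fold-isBialgebraHom : IsBialgebraHom μ ι♣ A c h
    fold-isBialgebraHom =
      fold-hom A , trans (rec-unique recursionStep covariant-side-solves)
                         (sym (rec-unique recursionStep contravariant-side-solves))

  ι♣-isInitial : IsInitialBialgebra μ ι♣
  ι♣-isInitial = ι♣-isBialgebra , λ A c c-bialg →
    fold A , FoldIsBialgebraHom.fold-isBialgebraHom A c c-bialg , λ h′ h′-hom → fold-unique A h′ (proj₁ h′-hom)

proposition4p20 : ∀ {o ℓ e} (C : Category o ℓ e)
    (lim : FiniteLimits C) (colim : FiniteColimits C)
    (V : Category.Obj C) (Σ′ : Endofunctor C)
    (freeΣ′ : FreeAlgebras C (Endofunctor.F₀ Σ′) (Endofunctor.F₁ Σ′))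
    (Σ⋆ : FreeAlgebras C (Setting.Σ₀ C lim colim V Σ′) (Setting.Σ₁ C lim colim V Σ′))
    (B : Bifunctor C)
    (init : InitialAlgebra C (Setting.Σ₀ C lim colim V Σ′) (Setting.Σ₁ C lim colim V Σ′))
    (ρ : Setting.FreeMonad.Law.GSOSLaw C lim colim V Σ′ Σ⋆ B) →
    Setting.FreeMonad.Law.Bialgebras.Proposition C lim colim V Σ′ Σ⋆ B ρ init
proposition4p20 C lim colim V Σ′ _ Σ⋆ B init ρ =
  ι♣ , ι♣-isBialgebra , isBialgebra⇒≈ι♣ , ι♣-isInitial
  where open Initiality C lim colim V Σ′ Σ⋆ B ρ init
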